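{- Let $\mathfrak{M}=(W,1,\curlywedge,V)$ and $\mathfrak{M}'=(W',1',\curlywedge',V')$ be L$_1$-models, $S\subseteq W\times W'$, and $T_S=\{(w_1,w_2,w')\in W\times W\times W'\mid (w_1,w')\in S\text{ or }(w_2,w')\in S\}$. Then $S$ is an L$_1$-simulation from $\mathfrak{M}$ to $\mathfrak{M}'$ if and only if $T_S$ is a meet-simulation from $\mathfrak{M}$ to $\mathfrak{M}'$.
   Context: A meet-semilattice $(W,1,\curlywedge)$ is a poset in which every finite subset has a meet; $\curlywedge$ binary meet, $1$ top, $w\preccurlyeq v$ iff $w\curlywedge v=w$. A filter is a $\preccurlyeq$-upward closed subset closed under finite meets. An L$_1$-model $(W,1,\curlywedge,V)$ is a meet-semilattice with a filter $V(p)$ for each $p$ in a fixed set $\mathrm{Prop}$. An L$_1$-simulation from $\mathfrak{M}$ to $\mathfrak{M}'$ is $S\subseteq W\times W'$ such that for all $(w,w')\in S$: (S1) $w\in V(p)$ implies $w'\in V'(p)$ for all $p$; (S2) $w=1$ implies $w'=1'$; (S3) if $v\curlywedge u\preccurlyeq w$ then there exist $v',u'\in W'$ with $(v,v'),(u,u')\in S$ and $v'\curlywedge'u'\preccurlyeq' w'$. A meet-simulation from $\mathfrak{M}$ to $\mathfrak{M}'$ is $T\subseteq W\times W\times W'$ such that for all $(w_1,w_2,w')\in T$: (M1) if $w_1,w_2\in V(p)$ then $w'\in V'(p)$, for all $p$; (M2) if $w_1=w_2=1$ then $w'=1'$; (M3) if $u_1\curlywedge v_1\preccurlyeq w_1$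 and $u_2\curlywedge v_2\preccurlyeq w_2$, then there exist $v',u'\in W'$ with $(u_1,u_2,u')\in T$, $(v_1,v_2,v')\in T$ and $v'\curlywedge'u'\preccurlyeq' w'$. -}

module Defs where

open import Data.Product using (Σ; _×_; _,_)
open import Data.Sum using (_⊎_)
open import Relation.Binary.PropositionalEquality using (_≡_)

-- A meet-semilattice with top, presented algebraically: a poset where every
-- finite subset has a meet is exactly an idempotent commutative monoid
-- (binary meet, empty meet = top 1), with w ≼ v iff w ⋏ v ≡ w.
record MeetSemilattice : Set₁ where
  field
    W       : Set
    one     : W
    _⋏_     : W → W → W
    ⋏-assoc : ∀ x y z → (x ⋏ y) ⋏ z ≡ x ⋏ (y ⋏ z)
    ⋏-comm  : ∀ x y → x ⋏ y ≡ y ⋏ x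
    ⋏-idem  : ∀ x → x ⋏ x ≡ x
    ⋏-one   : ∀ x → x ⋏ one ≡ x

  infixr 7 _⋏_
  infix 4 _≼_
  _≼_ : W → W → Set
  w ≼ v = w ⋏ v ≡ w

record IsFilter (L : MeetSemilattice) (F : MeetSemilattice.W L → Set) : Set where
  open MeetSemilattice L
  field
    upward : ∀ {w v} → F w → w ≼ v → F v
    top    : F one
    meet   : ∀ {w v} → F w → F v → F (w ⋏ v)

record L1Model (Prop : Set) : Set₁ where
  field
    frame    : MeetSemilattice
  open MeetSemilattice frame public
  field
    V        : Prop → W → Set
    V-filter : ∀ p → IsFilter frame (V p)

module _ {Prop : Set} (M M' : L1Model Prop) where
  private
    module M  = L1Model M
    module M' = L1Model M'

  IsL1Simulation : (M.W → M'.W → Set) → Set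
  IsL1Simulation S =
    ∀ w w' → S w w' →
      ((p : Prop) → M.V p w → M'.V p w')
      × (w ≡ M.one → w' ≡ M'.one)
      × (∀ v u → (v M.⋏ u) M.≼ w →
           Σ M'.W λ v' → Σ M'.W λ u' →
             S v v' × S u u' × ((v' M'.⋏ u') M'.≼ w'))

  IsMeetSimulation : (M.W → M.W → M'.W → Set) → Set
  IsMeetSimulation T =
    ∀ w₁ w₂ w' → T w₁ w₂ w' →
      ((p : Prop) → M.V p w₁ → M.V p w₂ → M'.V p w')
      × (w₁ ≡ M.one → w₂ ≡ M.one → w' ≡ M'.one)
      × (∀ u₁ v₁ u₂ v₂ → (u₁ M.⋏ v₁) M.≼ w₁ → (u₂ M.⋏ v₂) M.≼ w₂ →
           Σ M'.W λ v' → Σ M'.W λ u' →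
             T u₁ u₂ u' × T v₁ v₂ v' × ((v' M'.⋏ u') M'.≼ w'))

  T[_] : (M.W → M'.W → Set) → M.W → M.W → M'.W → Set
  T[ S ] w₁ w₂ w' = S w₁ w' ⊎ S w₂ w'

module Submission where

open import Defs
open import Data.Product using (_×_; _,_)
open import Data.Sum using (inj₁; inj₂; reduce)
open import Relation.Binary.PropositionalEquality using (_≡_; subst)

-- A triple in T_S is witnessed by one of its two coordinates alone, so the
-- forward direction runs the L1-simulation on that coordinate; conversely
-- S is recovered from T_S on the diagonal triples (w, w, w').

≼-⋏-comm : (L : MeetSemilattice) → let open MeetSemilattice L in
           ∀ {a b w} → a ⋏ b ≼ w → b ⋏ a ≼ w
≼-⋏-comm L {a} {b} {w} = subst (λ z → z ⋏ w ≡ z) (⋏-comm a b)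
  where open MeetSemilattice L

module _ {Prop : Set} (M M' : L1Model Prop) (S : L1Model.W M → L1Model.W M' → Set) where
  private
    module M = L1Model M

  L1Simulation⇒MeetSimulation : IsL1Simulation M M' S → IsMeetSimulation M M' (T[_] M M' S)
  L1Simulation⇒MeetSimulation sim w₁ w₂ w' (inj₁ s) with sim w₁ w' s
  ... | V⇒ , one⇒ , split =
    (λ p v₁ _ → V⇒ p v₁) ,
    (λ e₁ _ → one⇒ e₁) ,
    λ u₁ v₁ _ _ h₁ _ → let (v' , u' , sv , su , le) = split v₁ u₁ (≼-⋏-comm M.frame h₁)
                       in v' , u' , inj₁ su , inj₁ sv , le
  L1Simulation⇒MeetSimulation sim w₁ w₂ w' (inj₂ s) with sim w₂ w' s
  ... | V⇒ , one⇒ , split =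
    (λ p _ v₂ → V⇒ p v₂) ,
    (λ _ e₂ → one⇒ e₂) ,
    λ _ _ u₂ v₂ _ h₂ → let (v' , u' , sv , su , le) = split v₂ u₂ (≼-⋏-comm M.frame h₂)
                       in v' , u' , inj₂ su , inj₂ sv , le

  MeetSimulation⇒L1Simulation : IsMeetSimulation M M' (T[_] M M' S) → IsL1Simulation M M' S
  MeetSimulation⇒L1Simulation msim w w' s with msim w w w' (inj₁ s)
  ... | V⇒ , one⇒ , split =
    (λ p v → V⇒ p v v) ,
    (λ e → one⇒ e e) ,
    λ v u h → let h' = ≼-⋏-comm M.frame h
                  (v' , u' , tu , tv , le) = split u v u v h' h'
              in v' , u' , reduce tv , reduce tu , le

proposition7p8 : {Prop : Set} (M M' : L1Model Prop)
    (S : L1Model.W M → L1Model.W M' → Set) →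
    (IsL1Simulation M M' S → IsMeetSimulation M M' (T[_] M M' S))
    × (IsMeetSimulation M M' (T[_] M M' S) → IsL1Simulation M M' S)
proposition7p8 M M' S =
  L1Simulation⇒MeetSimulation M M' S , MeetSimulation⇒L1Simulation M M' S
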